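{- Let $G$ be a minimal counterexample as described in the context. Then $G$ contains no vertex $v$ of degree $8$ together with distinct neighbours $u,w,y,z,t$ of $v$ and a vertex $x\notin N(v)\cup\{v\}$ such that $ux,\ wx,\ wy,\ zt\in E(G)$, $d(u)=2$ and $d(w)=d(z)=3$.
   Context: A total $9$-coloring of a graph assigns to every vertex and every edge one of $9$ colors so that adjacent vertices, edges sharing an endpoint, and a vertex and an edge incident to it all receive different colors. A $4$-fan is a path $x_1x_2x_3x_4x_5$ together with one further vertex adjacent to all of $x_1,\dots,x_5$. A minimal counterexample is a simple planar graph $G$ of maximum degree $8$ containing no subgraph isomorphic to a $4$-fan, having no total $9$-coloring, with $|V(G)|+|E(G)|$ minimum among all such graphs; as part of this standing assumption, for every $x\in V(G)\cup E(G)$ the graph $G-x$ admits a total $9$-coloring. $N(v)$ is the neighbourhood of $v$ and $d(\cdot)$ denotes degree. (In the paper this is the configuration of Figure 6(e).) -}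

module Defs where

open import Data.Nat using (ℕ; zero; suc; pred; _+_; _≤_; _<ᵇ_)
open import Data.Bool using (Bool; true; false; _∧_; _∨_; not; if_then_else_)
open import Data.Fin using (Fin; toℕ; punchIn; _≟_)
open import Data.List using (List; map; allFin)
open import Data.Nat.ListAction using (sum)
open import Data.Maybe using (Maybe; just; nothing)
open import Data.Product using (Σ; ∃; _×_; _,_)
open import Relation.Nullary using (¬_)
open import Relation.Nullary.Decidable using (⌊_⌋)
open import Relation.Binary.PropositionalEquality using (_≡_; _≢_)
open import Function.Definitions using (Injective)

Graph : ℕ → Set
Graph n = Fin n → Fin n → Bool

IsSimple : ∀ {n} → Graph n → Set
IsSimple {n} G = (∀ (i j : Fin n) → G i j ≡ G j i) × (∀ (i : Fin n) → G i i ≡ false)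

Edge : ∀ {n} → Graph n → Fin n → Fin n → Set
Edge G i j = G i j ≡ true

deg : ∀ {n} → Graph n → Fin n → ℕ
deg {n} G v = sum (map (λ j → if G v j then 1 else 0) (allFin n))

edgeCount : ∀ {n} → Graph n → ℕ
edgeCount {n} G =
  sum (map (λ i → sum (map (λ j → if G i j ∧ (toℕ i <ᵇ toℕ j) then 1 else 0) (allFin n))) (allFin n))

size : ∀ {n} → Graph n → ℕ
size {n} G = n + edgeCount G

MaxDegree8 : ∀ {n} → Graph n → Set
MaxDegree8 {n} G = (∀ (v : Fin n) → deg G v ≤ 8) × (Σ (Fin n) λ v → deg G v ≡ 8)

record TotalColoring (k : ℕ) {n : ℕ} (G : Graph n) : Set where
  field
    vcol : Fin n → Fin k
    ecol : Fin n → Fin n → Fin k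
    ecol-sym : ∀ u v → Edge G u v → ecol u v ≡ ecol v u
    adj-vertices : ∀ u v → Edge G u v → vcol u ≢ vcol v
    adj-edges : ∀ u v w → Edge G u v → Edge G u w → v ≢ w → ecol u v ≢ ecol u w
    incident : ∀ u v → Edge G u v → vcol u ≢ ecol u v

TotalColorable : ℕ → ∀ {n} → Graph n → Set
TotalColorable k G = TotalColoring k G

-- G contains a subgraph isomorphic to a 4-fan: vertices f 0 (the centre)
-- and f 1 … f 5 (the path x₁…x₅), pairwise distinct.
Contains4Fan : ∀ {n} → Graph n → Set
Contains4Fan {n} G = Σ (Fin 6 → Fin n) λ f → Injective _≡_ _≡_ f ×
  (Edge G (f Fin.zero) (f (Fin.suc Fin.zero)) × Edge G (f Fin.zero) (f (Fin.suc (Fin.suc Fin.zero))) ×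
   Edge G (f Fin.zero) (f (Fin.suc (Fin.suc (Fin.suc Fin.zero)))) ×
   Edge G (f Fin.zero) (f (Fin.suc (Fin.suc (Fin.suc (Fin.suc Fin.zero))))) ×
   Edge G (f Fin.zero) (f (Fin.suc (Fin.suc (Fin.suc (Fin.suc (Fin.suc Fin.zero)))))) ×
   Edge G (f (Fin.suc Fin.zero)) (f (Fin.suc (Fin.suc Fin.zero))) ×
   Edge G (f (Fin.suc (Fin.suc Fin.zero))) (f (Fin.suc (Fin.suc (Fin.suc Fin.zero)))) ×
   Edge G (f (Fin.suc (Fin.suc (Fin.suc Fin.zero)))) (f (Fin.suc (Fin.suc (Fin.suc (Fin.suc Fin.zero))))) ×
   Edge G (f (Fin.suc (Fin.suc (Fin.suc (Fin.suc Fin.zero))))) (f (Fin.suc (Fin.suc (Fin.suc (Fin.suc (Fin.suc Fin.zero)))))))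
  where import Data.Fin as Fin

data WalkIn {n} (G : Graph n) (P : Fin n → Set) : Fin n → Fin n → Set where
  here : ∀ {u} → P u → WalkIn G P u u
  step : ∀ {u v w} → P u → Edge G u v → WalkIn G P v w → WalkIn G P u w

-- H (on Fin m) is a minor of G: branch sets given by β, nonempty, connected,
-- and adjacent whenever the corresponding vertices of H are adjacent.
IsMinor : ∀ {m n} → Graph m → Graph n → Set
IsMinor {m} {n} H G = Σ (Fin n → Maybe (Fin m)) λ β →
  (∀ (a : Fin m) → Σ (Fin n) λ v → β v ≡ just a) ×
  (∀ (a : Fin m) (u w : Fin n) → β u ≡ just a → β w ≡ just a →
     WalkIn G (λ x → β x ≡ just a) u w) ×
  (∀ (a b : Fin m) → Edge H a b →
     Σ (Fin n) λ u → Σ (Fin n) λ v → β u ≡ just a × β v ≡ just b × Edge G u v)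

K5 : Graph 5
K5 i j = not ⌊ i ≟ j ⌋

K33 : Graph 6
K33 i j = (toℕ i <ᵇ 3) ∧ not (toℕ j <ᵇ 3) ∨ (toℕ j <ᵇ 3) ∧ not (toℕ i <ᵇ 3)

-- Planarity via Wagner's theorem (no K5 or K3,3 minor).
Planar : ∀ {n} → Graph n → Set
Planar G = ¬ IsMinor K5 G × ¬ IsMinor K33 G

-- G − v (vertex deletion); vertices of G − v are renumbered by punchIn v.
deleteVertex : ∀ {n} → Graph n → Fin n → Graph (pred n)
deleteVertex {suc m} G v i j = G (punchIn v i) (punchIn v j)

deleteEdge : ∀ {n} → Graph n → Fin n → Fin n → Graph n
deleteEdge G u v i j =
  G i j ∧ not ((⌊ i ≟ u ⌋ ∧ ⌊ j ≟ v ⌋) ∨ (⌊ i ≟ v ⌋ ∧ ⌊ j ≟ u ⌋))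

IsCandidate : ∀ {n} → Graph n → Set
IsCandidate G = IsSimple G × Planar G × MaxDegree8 G × ¬ Contains4Fan G × ¬ TotalColorable 9 G

-- Minimal counterexample (including the standing assumption that every
-- G − x is totally 9-colourable).
record MinimalCounterexample {n : ℕ} (G : Graph n) : Set₁ where
  field
    candidate : IsCandidate G
    minimal : ∀ {m} (H : Graph m) → IsCandidate H → size G ≤ size H
    delV-colorable : ∀ (v : Fin n) → TotalColorable 9 (deleteVertex G v)
    delE-colorable : ∀ (u v : Fin n) → Edge G u v → TotalColorable 9 (deleteEdge G u v)

Config : ∀ {n} → Graph n → Set
Config {n} G = Σ (Fin n) λ v → Σ (Fin n) λ u → Σ (Fin n) λ w → Σ (Fin n) λ y →
  Σ (Fin n) λ z → Σ (Fin n) λ t → Σ (Fin n) λ x →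
  deg G v ≡ 8 ×
  Edge G v u × Edge G v w × Edge G v y × Edge G v z × Edge G v t ×
  u ≢ w × u ≢ y × u ≢ z × u ≢ t × w ≢ y × w ≢ z × w ≢ t × y ≢ z × y ≢ t × z ≢ t ×
  x ≢ v × ¬ Edge G v x ×
  Edge G u x × Edge G w x × Edge G w y × Edge G z t ×
  deg G u ≡ 2 × deg G w ≡ 3 × deg G z ≡ 3

-- By minimality, G − vu has a total 9-colouring φ.  Since d(v) = 8, some colour e is missing
-- at v in φ.  We recolour the nine edges uv, ux, wx, wv, wy, zv, zt, vy, vt: at each of v, x, y, t
-- the new colours of these edges are a rearrangement of the colours they had (together with e at v),
-- so they cannot clash with the edges and the vertex colour kept there.  A short case analysis on
-- coincidences among the old colours finds such a rearrangement that is also proper at u, w, z.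
-- Finally u, w, z have degree at most 3, so each sees at most 6 colours and is recoloured greedily.

module Submission where

open import Defs
open import Data.Bool using (true; false; if_then_else_)
open import Data.Bool.Properties using (∧-zeroʳ) renaming (_≟_ to _≟ᵇ_)
open import Data.Empty using (⊥-elim)
open import Data.Fin using (Fin; zero; suc; _≟_)
open import Data.Fin.Properties using (any?)
open import Data.List using (List; []; _∷_; _++_; map; filter; length; lookup; allFin; removeAt)
open import Data.List.Properties using (length-removeAt′; filter-notAll; length-++; length-map; length-tabulate)
open import Data.List.Membership.Propositional using (_∈_; _∉_; find)
open import Data.List.Membership.Propositional.Properties
  using (∈-filter⁺; ∈-filter⁻; ∈-allFin; ∈-map⁺; ∈-++⁺ˡ; ∈-++⁺ʳ; ∈-lookup)
import Data.List.Membership.DecPropositional as DecMembership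
open import Data.List.Relation.Unary.All using (All; []; _∷_; all?)
import Data.List.Relation.Unary.All as All
open import Data.List.Relation.Unary.All.Properties using (¬All⇒Any¬; All¬⇒¬Any; ¬Any⇒All¬)
import Data.List.Relation.Unary.All.Properties as All
open import Data.List.Relation.Unary.Any using (Any; here; there; index)
import Data.List.Relation.Unary.Any as Any
open import Data.List.Relation.Unary.AllPairs using ([]; _∷_)
open import Data.List.Relation.Unary.Unique.Propositional using (Unique)
open import Data.List.Relation.Unary.Unique.Propositional.Properties
  using (filter⁺; allFin⁺; take⁺; Unique[x∷xs]⇒x∉xs)
open import Data.List.Relation.Binary.Subset.Propositional using (_⊆_)
open import Data.List.Relation.Binary.Permutation.Propositional
  using (_↭_; ↭-refl; ↭-prep; ↭-swap; ↭-trans; ↭-sym; ↭⇒↭ₛ)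
open import Data.List.Relation.Binary.Permutation.Propositional.Properties using (shift; ∈-resp-↭)
import Data.List.Relation.Binary.Permutation.Setoid.Properties as Permutationₛ
open import Data.Maybe using (Maybe; just; nothing; fromMaybe; _>>=_)
open import Data.Nat using (ℕ; suc; _+_; _≤_; _<_; s≤s; z≤n)
open import Data.Nat.Properties using (≤-trans; <-≤-trans; ≤-reflexive; <-irrefl; _<?_; module ≤-Reasoning)
open import Data.Nat.ListAction using (sum)
open import Data.Product using (∃; _×_; _,_; proj₁; proj₂)
open import Data.Sum using (_⊎_; inj₁; inj₂)
import Data.Sum as Sum
open import Function using (_∘_; id)
open import Relation.Binary.Definitions using (DecidableEquality)
open import Relation.Binary.PropositionalEquality
  using (_≡_; _≢_; refl; sym; trans; cong; cong₂; subst; ≢-sym; setoid)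
open import Relation.Nullary using (¬_; Dec; yes; no; ¬?; contradiction)
open import Relation.Nullary.Decidable using (_×-dec_; _⊎-dec_; from-yes)

module _ {A : Set} where

  ∈-removeAt : ∀ {x y : A} {ys} (x∈ys : x ∈ ys) → y ∈ ys → y ≢ x → y ∈ removeAt ys (index x∈ys)
  ∈-removeAt (here refl)  (here refl)  y≢x = ⊥-elim (y≢x refl)
  ∈-removeAt (here refl)  (there y∈ys) _   = y∈ys
  ∈-removeAt (there _)    (here refl)  _   = here refl
  ∈-removeAt (there x∈ys) (there y∈ys) y≢x = there (∈-removeAt x∈ys y∈ys y≢x)

  unique-⊆⇒length≤ : ∀ {xs ys : List A} → Unique xs → xs ⊆ ys → length xs ≤ length ys
  unique-⊆⇒length≤ {[]}     _                  _     = z≤n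
  unique-⊆⇒length≤ {x ∷ xs} {ys} (x∉xs ∷ xs-unique) xs⊆ys =
    ≤-trans (s≤s (unique-⊆⇒length≤ xs-unique xs⊆ys−x)) (≤-reflexive (sym (length-removeAt′ ys (index x∈ys))))
    where
    x∈ys : x ∈ ys
    x∈ys = xs⊆ys (here refl)
    xs⊆ys−x : xs ⊆ removeAt ys (index x∈ys)
    xs⊆ys−x y∈xs =
      ∈-removeAt x∈ys (xs⊆ys (there y∈xs)) (λ y≡x → All¬⇒¬Any x∉xs (subst (_∈ xs) y≡x y∈xs))

  module _ (_≟ᴬ_ : DecidableEquality A) where
    open DecMembership _≟ᴬ_ using (_∈?_)

    shorter⇒∃∉ : ∀ {xs ys : List A} → Unique ys → length xs < length ys → ∃ λ y → y ∈ ys × y ∉ xs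
    shorter⇒∃∉ {xs} {ys} ys-unique xs<ys with all? (_∈? xs) ys
    ... | yes ys⊆xs = ⊥-elim (<-irrefl refl (<-≤-trans xs<ys (unique-⊆⇒length≤ ys-unique (All.lookup ys⊆xs))))
    ... | no ys⊈xs  = find (¬All⇒Any¬ (_∈? xs) ys ys⊈xs)

  map⁺-on : ∀ {B : Set} {P : A → Set} {f : A → B} {xs} →
            (∀ {a b} → P a → P b → a ≢ b → f a ≢ f b) → All P xs → Unique xs → Unique (map f xs)
  map⁺-on f-inj []         []               = []
  map⁺-on f-inj (pa ∷ pas) (a∉xs ∷ xs-uniq) =
    All.map⁺ (All.zipWith (λ (a≢b , pb) → f-inj pa pb a≢b) (a∉xs , pas)) ∷ map⁺-on f-inj pas xs-uniq

  Unique⇒lookup-injective : ∀ {xs : List A} → Unique xs → ∀ {i j} → lookup xs i ≡ lookup xs j → i ≡ j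
  Unique⇒lookup-injective {_ ∷ _} _               {zero}  {zero}  _  = refl
  Unique⇒lookup-injective {_ ∷ _} (x∉xs ∷ _)      {zero}  {suc j} x≡ =
    contradiction x≡ (All.lookup x∉xs (∈-lookup j))
  Unique⇒lookup-injective {_ ∷ _} (x∉xs ∷ _)      {suc i} {zero}  ≡x =
    contradiction (sym ≡x) (All.lookup x∉xs (∈-lookup i))
  Unique⇒lookup-injective {_ ∷ _} (_ ∷ xs-unique) {suc i} {suc j} eq =
    cong suc (Unique⇒lookup-injective xs-unique eq)

  Unique-resp-↭ : ∀ {xs ys : List A} → xs ↭ ys → Unique xs → Unique ys
  Unique-resp-↭ xs↭ys = Permutationₛ.Unique-resp-↭ (setoid A) (↭⇒↭ₛ xs↭ys)

module _ {n : ℕ} (G : Graph n) where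

  neighbours : Fin n → List (Fin n)
  neighbours p = filter (λ q → G p q ≟ᵇ true) (allFin n)

  Edge⇒∈-neighbours : ∀ {p q} → Edge G p q → q ∈ neighbours p
  Edge⇒∈-neighbours {p} {q} p~q = ∈-filter⁺ (λ q → G p q ≟ᵇ true) (∈-allFin q) p~q

  ∈-neighbours⇒Edge : ∀ {p q} → q ∈ neighbours p → Edge G p q
  ∈-neighbours⇒Edge {p} q∈N = proj₂ (∈-filter⁻ (λ q → G p q ≟ᵇ true) {xs = allFin n} q∈N)

  neighbours-unique : ∀ p → Unique (neighbours p)
  neighbours-unique p = filter⁺ (λ q → G p q ≟ᵇ true) {allFin n} (allFin⁺ n)

  length-neighbours : ∀ p → length (neighbours p) ≡ deg G p
  length-neighbours p = count (allFin n)
    where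
    count : ∀ qs → length (filter (λ q → G p q ≟ᵇ true) qs) ≡ sum (map (λ q → if G p q then 1 else 0) qs)
    count []       = refl
    count (q ∷ qs) with G p q
    ... | true  = cong suc (count qs)
    ... | false = count qs

  neighbours-exhausted : ∀ {p r xs} → Unique xs → All (Edge G p) xs → deg G p ≡ length xs → Edge G p r → r ∈ xs
  neighbours-exhausted {p} {r} {xs} xs-unique p~xs deg≡ p~r with DecMembership._∈?_ _≟_ r xs
  ... | yes r∈xs = r∈xs
  ... | no r∉xs  = ⊥-elim (<-irrefl refl (≤-trans (unique-⊆⇒length≤ (¬Any⇒All¬ xs r∉xs ∷ xs-unique) r∷xs⊆N)
                                                   (≤-reflexive (trans (length-neighbours p) deg≡))))
    where
    r∷xs⊆N : r ∷ xs ⊆ neighbours p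
    r∷xs⊆N (here refl)  = Edge⇒∈-neighbours p~r
    r∷xs⊆N (there q∈xs) = Edge⇒∈-neighbours (All.lookup p~xs q∈xs)

  extra-neighbour : ∀ {p xs} → length xs < deg G p → ∃ λ r → Edge G p r × r ∉ xs
  extra-neighbour {p} {xs} xs<deg
    with shorter⇒∃∉ _≟_ (neighbours-unique p) (subst (length xs <_) (sym (length-neighbours p)) xs<deg)
  ... | r , r∈N , r∉xs = r , ∈-neighbours⇒Edge r∈N , r∉xs

module _ {n : ℕ} {G : Graph n} (simple : IsSimple G) where

  edge-sym : ∀ {p q} → Edge G p q → Edge G q p
  edge-sym {p} {q} p~q = trans (proj₁ simple q p) p~q

  edge-irrefl : ∀ {p q} → Edge G p q → p ≢ q
  edge-irrefl {p} p~p refl = contradiction (trans (sym p~p) (proj₂ simple p)) λ ()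

module _ {n : ℕ} (G : Graph n) (a b : Fin n) where

  deleteEdge-⊆ : ∀ {p q} → Edge (deleteEdge G a b) p q → Edge G p q
  deleteEdge-⊆ {p} {q} p~q with G p q | p~q
  ... | true  | _  = refl
  ... | false | ()

  deleteEdge-removes : ¬ Edge (deleteEdge G a b) a b
  deleteEdge-removes a~b with a ≟ a | b ≟ b
  ... | yes _  | yes _  = contradiction (trans (sym (∧-zeroʳ (G a b))) a~b) λ ()
  ... | no a≢a | _      = a≢a refl
  ... | yes _  | no b≢b = b≢b refl

  deleteEdge-keeps : ∀ {p q} → Edge G p q → ¬ (p ≡ a × q ≡ b) → ¬ (p ≡ b × q ≡ a) →
                     Edge (deleteEdge G a b) p q
  deleteEdge-keeps {p} {q} p~q ¬ab ¬ba rewrite p~q with p ≟ a | q ≟ b | p ≟ b | q ≟ a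
  ... | yes p≡a | yes q≡b | _       | _       = ⊥-elim (¬ab (p≡a , q≡b))
  ... | _       | _       | yes p≡b | yes q≡a = ⊥-elim (¬ba (p≡b , q≡a))
  ... | no _    | _       | no _    | _       = refl
  ... | no _    | _       | yes _   | no _    = refl
  ... | yes _   | no _    | no _    | _       = refl
  ... | yes _   | no _    | yes _   | no _    = refl

module _ {n k : ℕ} {H : Graph n} (φ : TotalColoring k H) where
  open TotalColoring φ

  colours-at : ∀ {p qs} → All (Edge H p) qs → Unique qs → Unique (map (ecol p) qs)
  colours-at {p} = map⁺-on (adj-edges p _ _)

  colours-into : ∀ {p qs} → All (Edge H p) qs → Unique qs → Unique (map (λ q → ecol q p) qs)
  colours-into {p} = map⁺-on λ p~q p~r q≢r eq →
    adj-edges p _ _ p~q p~r q≢r (trans (ecol-sym p _ p~q) (trans eq (sym (ecol-sym p _ p~r))))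

  Missing : Fin n → Fin k → Set
  Missing p c = c ≢ vcol p × (∀ r → Edge H p r → ecol p r ≢ c)

  -- The colours that may be reused at p once the edges p q, q ∈ qs, are recoloured.
  Freed : Fin n → List (Fin n) → Fin k → Set
  Freed p qs c = Missing p c ⊎ Any (λ q → c ≡ ecol p q) qs

  module _ {p qs new palette} (new↭palette : new ↭ palette) (palette-freed : All (Freed p qs) palette)
           (p~qs : All (Edge H p) qs) where

    freed-≢-vcol : ∀ {c} → c ∈ new → vcol p ≢ c
    freed-≢-vcol c∈new with All.lookup palette-freed (∈-resp-↭ new↭palette c∈new)
    ... | inj₁ (c≢vcol , _) = ≢-sym c≢vcol
    ... | inj₂ c∈colours with find c∈colours
    ...   | q , q∈qs , c≡ = λ vcol≡c → incident p q (All.lookup p~qs q∈qs) (trans vcol≡c c≡)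

    freed-≢-ecol : ∀ {c r} → c ∈ new → Edge H p r → All (r ≢_) qs → c ≢ ecol p r
    freed-≢-ecol {r = r} c∈new p~r r≢qs with All.lookup palette-freed (∈-resp-↭ new↭palette c∈new)
    ... | inj₁ (_ , missing) = ≢-sym (missing r p~r)
    ... | inj₂ c∈colours with find c∈colours
    ...   | q , q∈qs , c≡ = λ c≡ecol →
            adj-edges p q r (All.lookup p~qs q∈qs) p~r (≢-sym (All.lookup r≢qs q∈qs)) (trans (sym c≡) c≡ecol)

module _ {n k : ℕ} {G : Graph n} {p q : Fin n} (φ : TotalColoring k (deleteEdge G p q)) where
  open TotalColoring φ

  missing-colour : Edge G p q → deg G p < k → ∃ (Missing φ p)
  missing-colour p~q deg<k =
    c , (λ c≡vcol → c∉used (here c≡vcol))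
      , λ r p~r ecol≡c → c∉used (there (subst (_∈ _) ecol≡c (ecol∈used p~r)))
    where
    others : List (Fin n)
    others = filter (λ r → ¬? (r ≟ q)) (neighbours G p)
    used : List (Fin k)
    used = vcol p ∷ map (ecol p) others
    ecol∈used : ∀ {r} → Edge (deleteEdge G p q) p r → ecol p r ∈ map (ecol p) others
    ecol∈used p~r = ∈-map⁺ (ecol p) (∈-filter⁺ (λ r → ¬? (r ≟ q))
                                                (Edge⇒∈-neighbours G (deleteEdge-⊆ G p q p~r))
                                                λ { refl → deleteEdge-removes G p q p~r })
    q-excluded : Any (λ r → ¬ (r ≢ q)) (neighbours G p)
    q-excluded = Any.map (λ q≡r r≢q → r≢q (sym q≡r)) (Edge⇒∈-neighbours G p~q)
    used<k : length used < length (allFin k)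
    used<k = begin-strict
      length used             ≡⟨ cong suc (length-map (ecol p) others) ⟩
      suc (length others)     ≤⟨ filter-notAll (λ r → ¬? (r ≟ q)) (neighbours G p) q-excluded ⟩
      length (neighbours G p) ≡⟨ length-neighbours G p ⟩
      deg G p                 <⟨ deg<k ⟩
      k                       ≡⟨ sym (length-tabulate id) ⟩
      length (allFin k)       ∎
      where open ≤-Reasoning
    free : ∃ λ c → c ∈ allFin k × c ∉ used
    free = shorter⇒∃∉ _≟_ (allFin⁺ k) used<k
    c : Fin k
    c = proj₁ free
    c∉used : c ∉ used
    c∉used = proj₂ (proj₂ free)

record TotalColoringExcept (k : ℕ) {n : ℕ} (G : Graph n) (S : List (Fin n)) : Set where
  field
    vcol : Fin n → Fin k
    ecol : Fin n → Fin n → Fin k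
    ecol-sym : ∀ p q → Edge G p q → ecol p q ≡ ecol q p
    adj-vertices : ∀ p q → Edge G p q → p ∉ S → q ∉ S → vcol p ≢ vcol q
    adj-edges : ∀ p q r → Edge G p q → Edge G p r → q ≢ r → ecol p q ≢ ecol p r
    incident : ∀ p q → Edge G p q → p ∉ S → vcol p ≢ ecol p q

total-coloring : ∀ {n k} {G : Graph n} → TotalColoringExcept k G [] → TotalColoring k G
total-coloring ψ = record
  { vcol = vcol ; ecol = ecol ; ecol-sym = ecol-sym ; adj-edges = adj-edges
  ; adj-vertices = λ p q p~q → adj-vertices p q p~q (λ ()) (λ ())
  ; incident = λ p q p~q → incident p q p~q (λ ()) }
  where open TotalColoringExcept ψ

module _ {n k : ℕ} {G : Graph n} (simple : IsSimple G) where

  recolour-vertex : ∀ {p S} → TotalColoringExcept k G (p ∷ S) → deg G p + deg G p < k →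
                    TotalColoringExcept k G S
  recolour-vertex {p} {S} ψ 2deg<k = record
    { vcol = vcol′ ; ecol = ecol ; ecol-sym = ecol-sym ; adj-vertices = adj-vertices′
    ; adj-edges = adj-edges ; incident = incident′ }
    where
    open TotalColoringExcept ψ

    taken : List (Fin k)
    taken = map vcol (neighbours G p) ++ map (ecol p) (neighbours G p)

    taken<k : length taken < length (allFin k)
    taken<k = begin-strict
      length taken
        ≡⟨ trans (length-++ (map vcol (neighbours G p)))
                 (cong₂ _+_ (length-map vcol (neighbours G p)) (length-map (ecol p) (neighbours G p))) ⟩
      length (neighbours G p) + length (neighbours G p)
        ≡⟨ cong₂ _+_ (length-neighbours G p) (length-neighbours G p) ⟩
      deg G p + deg G p <⟨ 2deg<k ⟩
      k                 ≡⟨ sym (length-tabulate id) ⟩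
      length (allFin k) ∎
      where open ≤-Reasoning

    free : ∃ λ c → c ∈ allFin k × c ∉ taken
    free = shorter⇒∃∉ _≟_ (allFin⁺ k) taken<k

    c : Fin k
    c = proj₁ free

    c≢vcol : ∀ {r} → Edge G p r → c ≢ vcol r
    c≢vcol p~r c≡ = proj₂ (proj₂ free)
      (∈-++⁺ˡ (subst (_∈ map vcol (neighbours G p)) (sym c≡) (∈-map⁺ vcol (Edge⇒∈-neighbours G p~r))))

    c≢ecol : ∀ {r} → Edge G p r → c ≢ ecol p r
    c≢ecol p~r c≡ = proj₂ (proj₂ free)
      (∈-++⁺ʳ (map vcol (neighbours G p))
        (subst (_∈ map (ecol p) (neighbours G p)) (sym c≡) (∈-map⁺ (ecol p) (Edge⇒∈-neighbours G p~r))))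

    vcol′ : Fin n → Fin k
    vcol′ r with r ≟ p
    ... | yes _ = c
    ... | no _  = vcol r

    unexempt : ∀ {r} → r ≢ p → r ∉ S → r ∉ p ∷ S
    unexempt r≢p r∉S (here r≡p)  = r≢p r≡p
    unexempt r≢p r∉S (there r∈S) = r∉S r∈S

    adj-vertices′ : ∀ q r → Edge G q r → q ∉ S → r ∉ S → vcol′ q ≢ vcol′ r
    adj-vertices′ q r q~r q∉S r∉S with q ≟ p | r ≟ p
    ... | yes refl | yes refl = ⊥-elim (edge-irrefl simple q~r refl)
    ... | yes refl | no r≢p  = c≢vcol q~r
    ... | no q≢p  | yes refl = c≢vcol (edge-sym simple q~r) ∘ sym
    ... | no q≢p  | no r≢p  = adj-vertices q r q~r (unexempt q≢p q∉S) (unexempt r≢p r∉S)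

    incident′ : ∀ q r → Edge G q r → q ∉ S → vcol′ q ≢ ecol q r
    incident′ q r q~r q∉S with q ≟ p
    ... | yes refl = c≢ecol q~r
    ... | no q≢p   = incident q r q~r (unexempt q≢p q∉S)

module SymmetricTable {R C : Set} (_≟ᴿ_ : DecidableEquality R) where

  Entry : Set
  Entry = R × R × C

  Joins : Entry → R → R → Set
  Joins (a , b , _) ρ σ = (a ≡ ρ × b ≡ σ) ⊎ (a ≡ σ × b ≡ ρ)

  Incident : Entry → R → Set
  Incident (a , b , _) ρ = a ≡ ρ ⊎ b ≡ ρ

  joins? : ∀ ε ρ σ → Dec (Joins ε ρ σ)
  joins? (a , b , _) ρ σ = ((a ≟ᴿ ρ) ×-dec (b ≟ᴿ σ)) ⊎-dec ((a ≟ᴿ σ) ×-dec (b ≟ᴿ ρ))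

  incident? : ∀ ε ρ → Dec (Incident ε ρ)
  incident? (a , b , _) ρ = (a ≟ᴿ ρ) ⊎-dec (b ≟ᴿ ρ)

  colour : Entry → C
  colour (_ , _ , c) = c

  entry : List Entry → R → R → Maybe C
  entry []      ρ σ = nothing
  entry (ε ∷ T) ρ σ with joins? ε ρ σ
  ... | yes _ = just (colour ε)
  ... | no _  = entry T ρ σ

  star : List Entry → R → List C
  star []      ρ = []
  star (ε ∷ T) ρ with incident? ε ρ
  ... | yes _ = colour ε ∷ star T ρ
  ... | no _  = star T ρ

  joins-sym : ∀ ε {ρ σ} → Joins ε ρ σ → Joins ε σ ρ
  joins-sym _ = Sum.swap

  joins⇒incident : ∀ ε {ρ σ} → Joins ε ρ σ → Incident ε ρ
  joins⇒incident _ (inj₁ (a≡ρ , _)) = inj₁ a≡ρ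
  joins⇒incident _ (inj₂ (_ , b≡ρ)) = inj₂ b≡ρ

  joins-functional : ∀ ε {ρ σ σ′} → Joins ε ρ σ → Joins ε ρ σ′ → σ ≡ σ′
  joins-functional _ (inj₁ (refl , refl)) (inj₁ (_ , refl))    = refl
  joins-functional _ (inj₁ (refl , refl)) (inj₂ (refl , refl)) = refl
  joins-functional _ (inj₂ (refl , refl)) (inj₁ (refl , refl)) = refl
  joins-functional _ (inj₂ (refl , refl)) (inj₂ (refl , _))    = refl

  entry-sym : ∀ T ρ σ → entry T ρ σ ≡ entry T σ ρ
  entry-sym []      ρ σ = refl
  entry-sym (ε ∷ T) ρ σ with joins? ε ρ σ | joins? ε σ ρ
  ... | yes _ | yes _ = refl
  ... | no _  | no _  = entry-sym T ρ σ
  ... | yes j | no ¬j = contradiction (joins-sym ε j) ¬j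
  ... | no ¬j | yes j = contradiction (joins-sym ε j) ¬j

  entry∈star : ∀ T {ρ σ c} → entry T ρ σ ≡ just c → c ∈ star T ρ
  entry∈star (ε ∷ T) {ρ} {σ} eq with joins? ε ρ σ | incident? ε ρ
  entry∈star (ε ∷ T) refl | yes _ | yes _ = here refl
  ... | yes j | no ¬i = contradiction (joins⇒incident ε j) ¬i
  ... | no _  | yes _ = there (entry∈star T eq)
  ... | no _  | no _  = entry∈star T eq

  entry-injective : ∀ T {ρ σ σ′ c c′} → Unique (star T ρ) →
                    entry T ρ σ ≡ just c → entry T ρ σ′ ≡ just c′ → σ ≢ σ′ → c ≢ c′
  entry-injective (ε ∷ T) {ρ} {σ} {σ′} uniq eq eq′ σ≢σ′ with joins? ε ρ σ | joins? ε ρ σ′ | incident? ε ρ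
  ... | yes j | yes j′ | _     = contradiction (joins-functional ε j j′) σ≢σ′
  ... | yes j | no _   | no ¬i = contradiction (joins⇒incident ε j) ¬i
  ... | no _  | yes j′ | no ¬i = contradiction (joins⇒incident ε j′) ¬i
  ... | no _  | no _   | no _  = entry-injective T uniq eq eq′ σ≢σ′
  entry-injective (ε ∷ T) (_ ∷ uniq) eq eq′ σ≢σ′ | no _ | no _ | yes _ = entry-injective T uniq eq eq′ σ≢σ′
  entry-injective (ε ∷ T) uniq refl eq′ _ | yes _ | no _ | yes _ =
    λ c≡c′ → Unique[x∷xs]⇒x∉xs uniq (subst (_∈ star T _) (sym c≡c′) (entry∈star T eq′))
  entry-injective (ε ∷ T) uniq eq refl _ | no _ | yes _ | yes _ =
    λ c≡c′ → Unique[x∷xs]⇒x∉xs uniq (subst (_∈ star T _) c≡c′ (entry∈star T eq))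

module TableRecolouring {n k : ℕ} (G : Graph n) {H : Graph n} (φ : TotalColoring k H)
  (labelled : List (Fin n)) (labelled-unique : Unique labelled)
  (table : List (Fin (length labelled) × Fin (length labelled) × Fin k)) where

  open TotalColoring φ renaming (vcol to φv; ecol to φe)
  open SymmetricTable {Fin (length labelled)} {Fin k} _≟_ public using (star)
  open SymmetricTable {Fin (length labelled)} {Fin k} _≟_ using (entry; entry-sym; entry∈star; entry-injective)

  Label : Set
  Label = Fin (length labelled)

  ι : Label → Fin n
  ι = lookup labelled

  labelOf : Fin n → Maybe Label
  labelOf p with any? (λ ρ → ι ρ ≟ p)
  ... | yes (ρ , _) = just ρ
  ... | no _        = nothing

  labelOf-ι : ∀ ρ → labelOf (ι ρ) ≡ just ρ
  labelOf-ι ρ with any? (λ σ → ι σ ≟ ι ρ)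
  ... | yes (σ , ισ≡ιρ) = cong just (Unique⇒lookup-injective labelled-unique ισ≡ιρ)
  ... | no ∄            = contradiction (ρ , refl) ∄

  labelOf-just : ∀ {p ρ} → labelOf p ≡ just ρ → ι ρ ≡ p
  labelOf-just {p} eq with any? (λ σ → ι σ ≟ p) | eq
  ... | yes (_ , ιρ≡p) | refl = ιρ≡p

  newColour : Fin n → Fin n → Maybe (Fin k)
  newColour p q = labelOf p >>= λ ρ → labelOf q >>= entry table ρ

  newColour-ι : ∀ ρ σ → newColour (ι ρ) (ι σ) ≡ entry table ρ σ
  newColour-ι ρ σ rewrite labelOf-ι ρ | labelOf-ι σ = refl

  newColour-sym : ∀ p q → newColour p q ≡ newColour q p
  newColour-sym p q with labelOf p | labelOf q
  ... | just ρ  | just σ  = entry-sym table ρ σ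
  ... | just _  | nothing = refl
  ... | nothing | just _  = refl
  ... | nothing | nothing = refl

  recoloured-labelled : ∀ {p q c} → newColour p q ≡ just c → ∃ λ ρ → ι ρ ≡ p
  recoloured-labelled {p} eq with labelOf p in eqp
  ... | just ρ = ρ , labelOf-just eqp

  recoloured-at : ∀ {ρ q c} → newColour (ι ρ) q ≡ just c → ∃ λ σ → ι σ ≡ q × entry table ρ σ ≡ just c
  recoloured-at {ρ} {q} eq rewrite labelOf-ι ρ with labelOf q in eqq
  ... | just σ = σ , labelOf-just eqq , eq

  unchanged⇒≢ : ∀ ρ σ {c r} → entry table ρ σ ≡ just c → newColour (ι ρ) r ≡ nothing → r ≢ ι σ
  unchanged⇒≢ ρ σ entry≡c unchanged refl =
    contradiction (trans (sym entry≡c) (trans (sym (newColour-ι ρ σ)) unchanged)) λ ()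

  ecol′ : Fin n → Fin n → Fin k
  ecol′ p q = fromMaybe (φe p q) (newColour p q)

  record Admissible (S : List (Fin n)) : Set where
    field
      unchanged⇒kept : ∀ {p q} → Edge G p q → newColour p q ≡ nothing → Edge H p q
      unexempt⇒kept : ∀ {p q} → Edge G p q → p ∉ S → q ∉ S → Edge H p q
      star-unique : ∀ ρ → Unique (star table ρ)
      star-fresh-at-edges : ∀ ρ {c r} → c ∈ star table ρ → Edge G (ι ρ) r → newColour (ι ρ) r ≡ nothing →
                            c ≢ φe (ι ρ) r
      star-fresh-at-vertex : ∀ ρ {c} → ι ρ ∉ S → c ∈ star table ρ → φv (ι ρ) ≢ c

  recoloured : ∀ {S} → Admissible S → TotalColoringExcept k G S
  recoloured {S} admissible = record
    { vcol = φv ; ecol = ecol′ ; ecol-sym = ecol′-sym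
    ; adj-vertices = λ p q p~q p∉S q∉S → adj-vertices p q (unexempt⇒kept p~q p∉S q∉S)
    ; adj-edges = ecol′-adj-edges ; incident = ecol′-incident }
    where
    open Admissible admissible

    ecol′-sym : ∀ p q → Edge G p q → ecol′ p q ≡ ecol′ q p
    ecol′-sym p q p~q rewrite newColour-sym q p with newColour p q in eq
    ... | just _  = refl
    ... | nothing = ecol-sym p q (unchanged⇒kept p~q eq)

    recoloured-vs-kept : ∀ {p q r c} → newColour p q ≡ just c → Edge G p r → newColour p r ≡ nothing →
                         c ≢ φe p r
    recoloured-vs-kept eq p~r unchanged with recoloured-labelled eq
    ... | ρ , refl with recoloured-at {ρ} eq
    ...   | _ , _ , entry≡c = star-fresh-at-edges ρ (entry∈star table entry≡c) p~r unchanged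

    both-recoloured : ∀ {p q r c c′} → newColour p q ≡ just c → newColour p r ≡ just c′ → q ≢ r → c ≢ c′
    both-recoloured eq eq′ q≢r with recoloured-labelled eq
    ... | ρ , refl with recoloured-at {ρ} eq | recoloured-at {ρ} eq′
    ...   | _ , refl , entry≡c | _ , refl , entry≡c′ =
            entry-injective table (star-unique ρ) entry≡c entry≡c′ (λ { refl → q≢r refl })

    ecol′-adj-edges : ∀ p q r → Edge G p q → Edge G p r → q ≢ r → ecol′ p q ≢ ecol′ p r
    ecol′-adj-edges p q r p~q p~r q≢r with newColour p q in eq | newColour p r in eq′
    ... | just _  | just _  = both-recoloured eq eq′ q≢r
    ... | just _  | nothing = recoloured-vs-kept eq p~r eq′
    ... | nothing | just _  = ≢-sym (recoloured-vs-kept eq′ p~q eq)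
    ... | nothing | nothing = adj-edges p q r (unchanged⇒kept p~q eq) (unchanged⇒kept p~r eq′) q≢r

    ecol′-incident : ∀ p q → Edge G p q → p ∉ S → φv p ≢ ecol′ p q
    ecol′-incident p q p~q p∉S with newColour p q in eq
    ... | nothing = incident p q (unchanged⇒kept p~q eq)
    ... | just _ with recoloured-labelled eq
    ...   | ρ , refl with recoloured-at {ρ} eq
    ...     | _ , _ , entry≡c = star-fresh-at-vertex ρ p∉S (entry∈star table entry≡c)

-- The parameters are the old colours of the edges they are named after (zz′ is the third edge at z)
-- and a colour e missing at v; the primed fields are the new colours of the recoloured edges.
record Recolouring {A : Set} (ux wx wv wy zv zt vy vt zz′ e : A) : Set where
  field
    uv′ ux′ wv′ wx′ wy′ zv′ zt′ vy′ vt′ : A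
    at-v : uv′ ∷ wv′ ∷ zv′ ∷ vy′ ∷ vt′ ∷ [] ↭ e ∷ wv ∷ zv ∷ vy ∷ vt ∷ []
    at-x : ux′ ∷ wx′ ∷ [] ↭ ux ∷ wx ∷ []
    at-y : wy′ ∷ vy′ ∷ [] ↭ wy ∷ vy ∷ []
    at-t : zt′ ∷ vt′ ∷ [] ↭ zt ∷ vt ∷ []
    at-u : uv′ ≢ ux′
    at-w : Unique (wv′ ∷ wx′ ∷ wy′ ∷ [])
    at-z : Unique (zv′ ∷ zt′ ∷ zz′ ∷ [])

module _ {A : Set} where

  missing-on-uv : ∀ {ux wx wv wy zv zt vy vt zz′ e : A} →
    e ≢ ux → Unique (wv ∷ wx ∷ wy ∷ []) → Unique (zv ∷ zt ∷ zz′ ∷ []) →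
    Recolouring ux wx wv wy zv zt vy vt zz′ e
  missing-on-uv {ux} {wx} {wv} {wy} {zv} {zt} {vy} {vt} {zz′} {e} e≢ux w-proper z-proper = record
    { uv′ = e ; ux′ = ux ; wv′ = wv ; wx′ = wx ; wy′ = wy ; zv′ = zv ; zt′ = zt ; vy′ = vy ; vt′ = vt
    ; at-v = ↭-refl ; at-x = ↭-refl ; at-y = ↭-refl ; at-t = ↭-refl
    ; at-u = e≢ux ; at-w = w-proper ; at-z = z-proper }

  missing-on-wv : ∀ {wx wv wy zv zt vy vt zz′ e : A} →
    wv ≢ e → Unique (e ∷ wx ∷ wy ∷ []) → Unique (zv ∷ zt ∷ zz′ ∷ []) →
    Recolouring e wx wv wy zv zt vy vt zz′ e
  missing-on-wv {wx} {wv} {wy} {zv} {zt} {vy} {vt} {zz′} {e} wv≢e w-proper z-proper = record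
    { uv′ = wv ; ux′ = e ; wv′ = e ; wx′ = wx ; wy′ = wy ; zv′ = zv ; zt′ = zt ; vy′ = vy ; vt′ = vt
    ; at-v = ↭-swap wv e ↭-refl ; at-x = ↭-refl ; at-y = ↭-refl ; at-t = ↭-refl
    ; at-u = wv≢e ; at-w = w-proper ; at-z = z-proper }

  missing-on-zv : ∀ {wx wv zv zt vy vt zz′ e : A} →
    zv ≢ e → Unique (wv ∷ wx ∷ e ∷ []) → Unique (e ∷ zt ∷ zz′ ∷ []) →
    Recolouring e wx wv e zv zt vy vt zz′ e
  missing-on-zv {wx} {wv} {zv} {zt} {vy} {vt} {zz′} {e} zv≢e w-proper z-proper = record
    { uv′ = zv ; ux′ = e ; wv′ = wv ; wx′ = wx ; wy′ = e ; zv′ = e ; zt′ = zt ; vy′ = vy ; vt′ = vt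
    ; at-v = ↭-trans (shift e (zv ∷ wv ∷ []) (vy ∷ vt ∷ [])) (↭-prep e (↭-swap zv wv ↭-refl))
    ; at-x = ↭-refl ; at-y = ↭-refl ; at-t = ↭-refl
    ; at-u = zv≢e ; at-w = w-proper ; at-z = z-proper }

  missing-on-vt : ∀ {wx wv zv vy vt e : A} →
    vt ≢ e → Unique (wv ∷ wx ∷ e ∷ []) → Unique (zv ∷ vt ∷ vy ∷ []) →
    Recolouring e wx wv e zv e vy vt vy e
  missing-on-vt {wx} {wv} {zv} {vy} {vt} {e} vt≢e w-proper z-proper = record
    { uv′ = vt ; ux′ = e ; wv′ = wv ; wx′ = wx ; wy′ = e ; zv′ = zv ; zt′ = vt ; vy′ = vy ; vt′ = e
    ; at-v = ↭-trans (shift e (vt ∷ wv ∷ zv ∷ vy ∷ []) [])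
                     (↭-prep e (↭-sym (shift vt (wv ∷ zv ∷ vy ∷ []) [])))
    ; at-x = ↭-refl ; at-y = ↭-refl ; at-t = ↭-swap vt e ↭-refl
    ; at-u = vt≢e ; at-w = w-proper ; at-z = z-proper }

  missing-on-vy-through-zv : ∀ {wx wv zv zt vy vt zz′ e : A} →
    wv ≢ wx → Unique (zv ∷ e ∷ vy ∷ []) → Unique (vy ∷ zt ∷ zz′ ∷ []) →
    Recolouring e wx wv e zv zt vy vt zz′ e
  missing-on-vy-through-zv {wx} {wv} {zv} {zt} {vy} {vt} {zz′} {e} wv≢wx w-proper z-proper = record
    { uv′ = wv ; ux′ = wx ; wv′ = zv ; wx′ = e ; wy′ = vy ; zv′ = vy ; zt′ = zt ; vy′ = e ; vt′ = vt
    ; at-v = shift e (wv ∷ zv ∷ vy ∷ []) (vt ∷ [])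
    ; at-x = ↭-swap wx e ↭-refl ; at-y = ↭-swap vy e ↭-refl ; at-t = ↭-refl
    ; at-u = wv≢wx ; at-w = w-proper ; at-z = z-proper }

  missing-on-vy-through-vt : ∀ {wx wv zv vy vt e : A} →
    wv ≢ wx → Unique (vt ∷ e ∷ vy ∷ []) → Unique (zv ∷ vt ∷ e ∷ []) →
    Recolouring e wx wv e zv vy vy vt e e
  missing-on-vy-through-vt {wx} {wv} {zv} {vy} {vt} {e} wv≢wx w-proper z-proper = record
    { uv′ = wv ; ux′ = wx ; wv′ = vt ; wx′ = e ; wy′ = vy ; zv′ = zv ; zt′ = vt ; vy′ = e ; vt′ = vy
    ; at-v = ↭-trans (shift e (wv ∷ vt ∷ zv ∷ []) (vy ∷ []))
                     (↭-prep e (↭-prep wv (↭-sym (shift vt (zv ∷ vy ∷ []) []))))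
    ; at-x = ↭-swap wx e ↭-refl ; at-y = ↭-swap vy e ↭-refl ; at-t = ↭-swap vt vy ↭-refl
    ; at-u = wv≢wx ; at-w = w-proper ; at-z = z-proper }

  recolouring : DecidableEquality A → ∀ {ux wx wv wy zv zt vy vt zz′ e} →
    Unique (ux ∷ wx ∷ []) → Unique (e ∷ wv ∷ zv ∷ vy ∷ vt ∷ []) →
    Unique (wv ∷ wx ∷ wy ∷ []) → Unique (zv ∷ zt ∷ zz′ ∷ []) →
    Recolouring ux wx wv wy zv zt vy vt zz′ e
  recolouring _≟ᴬ_ {ux} {wx} {wv} {wy} {zv} {zt} {vy} {vt} {zz′} {e}
    ((ux≢wx ∷ []) ∷ [] ∷ [])
    ((e≢wv ∷ e≢zv ∷ e≢vy ∷ e≢vt ∷ []) ∷ _ ∷ (zv≢vy ∷ zv≢vt ∷ []) ∷ (vy≢vt ∷ []) ∷ [] ∷ [])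
    w-proper@((wv≢wx ∷ _) ∷ (wx≢wy ∷ []) ∷ [] ∷ [])
    z-proper@((_ ∷ zv≢zz′ ∷ []) ∷ (zt≢zz′ ∷ []) ∷ [] ∷ [])
    with ux ≟ᴬ e
  ... | no ux≢e = missing-on-uv (≢-sym ux≢e) w-proper z-proper
  ... | yes refl with wy ≟ᴬ ux
  ...   | no wy≢e =
            missing-on-wv (≢-sym e≢wv) ((ux≢wx ∷ ≢-sym wy≢e ∷ []) ∷ (wx≢wy ∷ []) ∷ [] ∷ []) z-proper
  -- Now ux = wy = e.  As e ≢ vy and zt ≢ zz′, if neither e nor vy avoids {zt, zz′},
  -- then {e, vy} = {zt, zz′}.
  ...   | yes refl with zz′ ≟ᴬ ux | zt ≟ᴬ ux | zz′ ≟ᴬ vy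
  ...     | no zz′≢e | no zt≢e | _ =
              missing-on-zv (≢-sym e≢zv) w-proper
                            ((≢-sym zt≢e ∷ ≢-sym zz′≢e ∷ []) ∷ (zt≢zz′ ∷ []) ∷ [] ∷ [])
  ...     | _ | yes refl | yes refl =
              missing-on-vt (≢-sym e≢vt) w-proper ((zv≢vt ∷ zv≢vy ∷ []) ∷ (≢-sym vy≢vt ∷ []) ∷ [] ∷ [])
  ...     | _ | yes refl | no zz′≢vy =
              missing-on-vy-through-zv wv≢wx ((≢-sym e≢zv ∷ zv≢vy ∷ []) ∷ (e≢vy ∷ []) ∷ [] ∷ [])
                                       ((≢-sym e≢vy ∷ ≢-sym zz′≢vy ∷ []) ∷ (zt≢zz′ ∷ []) ∷ [] ∷ [])
  ...     | yes refl | no _ | _ with zt ≟ᴬ vy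
  ...       | yes refl =
              missing-on-vy-through-vt wv≢wx ((≢-sym e≢vt ∷ ≢-sym vy≢vt ∷ []) ∷ (e≢vy ∷ []) ∷ [] ∷ [])
                                       ((zv≢vt ∷ zv≢zz′ ∷ []) ∷ (≢-sym e≢vt ∷ []) ∷ [] ∷ [])
  ...       | no zt≢vy =
              missing-on-vy-through-zv wv≢wx ((≢-sym e≢zv ∷ zv≢vy ∷ []) ∷ (e≢vy ∷ []) ∷ [] ∷ [])
                                       ((≢-sym zt≢vy ∷ ≢-sym e≢vy ∷ []) ∷ (zt≢zz′ ∷ []) ∷ [] ∷ [])

-- Positions in Figure6e.labelled.
pattern V = zero
pattern U = suc zero
pattern W = suc (suc zero)
pattern Y = suc (suc (suc zero))
pattern Z = suc (suc (suc (suc zero)))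
pattern T = suc (suc (suc (suc (suc zero))))
pattern X = suc (suc (suc (suc (suc (suc zero)))))

module Figure6e {n : ℕ} {G : Graph n} (simple : IsSimple G) {v u w y z t x : Fin n}
  (deg-v : deg G v ≡ 8) (v~u : Edge G v u) (v~w : Edge G v w) (v~y : Edge G v y) (v~z : Edge G v z) (v~t : Edge G v t)
  (u≢w : u ≢ w) (u≢y : u ≢ y) (u≢z : u ≢ z) (u≢t : u ≢ t) (w≢y : w ≢ y) (w≢z : w ≢ z) (w≢t : w ≢ t)
  (y≢z : y ≢ z) (y≢t : y ≢ t) (z≢t : z ≢ t) (x≢v : x ≢ v) (v≁x : ¬ Edge G v x)
  (u~x : Edge G u x) (w~x : Edge G w x) (w~y : Edge G w y) (z~t : Edge G z t)
  (deg-u : deg G u ≡ 2) (deg-w : deg G w ≡ 3) (deg-z : deg G z ≡ 3)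
  (φ : TotalColoring 9 (deleteEdge G v u)) where

  open TotalColoring φ renaming (vcol to φv; ecol to φe)

  H : Graph n
  H = deleteEdge G v u

  irrefl : ∀ {p q} → Edge G p q → p ≢ q
  irrefl = edge-irrefl simple

  neighbour-of-v≢x : ∀ {p} → Edge G v p → p ≢ x
  neighbour-of-v≢x v~p refl = v≁x v~p

  labelled : List (Fin n)
  labelled = v ∷ u ∷ w ∷ y ∷ z ∷ t ∷ x ∷ []

  labelled-unique : Unique labelled
  labelled-unique =
      (irrefl v~u ∷ irrefl v~w ∷ irrefl v~y ∷ irrefl v~z ∷ irrefl v~t ∷ ≢-sym x≢v ∷ [])
    ∷ (u≢w ∷ u≢y ∷ u≢z ∷ u≢t ∷ irrefl u~x ∷ [])
    ∷ (w≢y ∷ w≢z ∷ w≢t ∷ irrefl w~x ∷ [])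
    ∷ (y≢z ∷ y≢t ∷ neighbour-of-v≢x v~y ∷ [])
    ∷ (z≢t ∷ neighbour-of-v≢x v~z ∷ [])
    ∷ (neighbour-of-v≢x v~t ∷ [])
    ∷ [] ∷ []

  vxy-unique : Unique (v ∷ x ∷ y ∷ [])
  vxy-unique = (≢-sym x≢v ∷ irrefl v~y ∷ []) ∷ (≢-sym (neighbour-of-v≢x v~y) ∷ []) ∷ [] ∷ []

  u-neighbours : ∀ {r} → Edge G u r → r ∈ v ∷ x ∷ []
  u-neighbours = neighbours-exhausted G ((≢-sym x≢v ∷ []) ∷ [] ∷ []) (edge-sym simple v~u ∷ u~x ∷ []) deg-u

  w-neighbours : ∀ {r} → Edge G w r → r ∈ v ∷ x ∷ y ∷ []
  w-neighbours = neighbours-exhausted G vxy-unique (edge-sym simple v~w ∷ w~x ∷ w~y ∷ []) deg-w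

  -- Kept abstract: unfolding these witnesses makes type checking of the case analyses below explode.
  abstract
    third-neighbour : ∃ λ z′ → Edge G z z′ × z′ ∉ v ∷ t ∷ []
    third-neighbour = extra-neighbour G (subst (2 <_) (sym deg-z) (from-yes (2 <? 3)))

    e-missing : ∃ (Missing φ v)
    e-missing = missing-colour φ v~u (subst (_< 9) (sym deg-v) (from-yes (8 <? 9)))

  z′ : Fin n
  z′ = proj₁ third-neighbour

  z~z′ : Edge G z z′
  z~z′ = proj₁ (proj₂ third-neighbour)

  vtz′-unique : Unique (v ∷ t ∷ z′ ∷ [])
  vtz′-unique = (irrefl v~t ∷ (λ v≡z′ → z′∉ (here (sym v≡z′))) ∷ [])
              ∷ ((λ t≡z′ → z′∉ (there (here (sym t≡z′)))) ∷ []) ∷ [] ∷ []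
    where
    z′∉ : z′ ∉ v ∷ t ∷ []
    z′∉ = proj₂ (proj₂ third-neighbour)

  z-neighbours : ∀ {r} → Edge G z r → r ∈ v ∷ t ∷ z′ ∷ []
  z-neighbours = neighbours-exhausted G vtz′-unique (edge-sym simple v~z ∷ z~t ∷ z~z′ ∷ []) deg-z

  e : Fin 9
  e = proj₁ e-missing

  kept-from : ∀ {p q} → Edge G p q → p ≢ v → p ≢ u → Edge H p q
  kept-from p~q p≢v p≢u = deleteEdge-keeps G v u p~q (p≢v ∘ proj₁) (p≢u ∘ proj₁)

  kept-from-v : ∀ {q} → Edge G v q → q ≢ u → Edge H v q
  kept-from-v v~q q≢u = deleteEdge-keeps G v u v~q (q≢u ∘ proj₂) (irrefl v~u ∘ proj₁)

  v~wzyt : All (Edge H v) (w ∷ z ∷ y ∷ t ∷ [])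
  v~wzyt = kept-from-v v~w (≢-sym u≢w) ∷ kept-from-v v~z (≢-sym u≢z) ∷ kept-from-v v~y (≢-sym u≢y)
         ∷ kept-from-v v~t (≢-sym u≢t) ∷ []

  x~uw : All (Edge H x) (u ∷ w ∷ [])
  x~uw = All.map (λ x~q → kept-from x~q x≢v (≢-sym (irrefl u~x))) (edge-sym simple u~x ∷ edge-sym simple w~x ∷ [])

  w~vxy : All (Edge H w) (v ∷ x ∷ y ∷ [])
  w~vxy = All.map (λ w~q → kept-from w~q (≢-sym (irrefl v~w)) (≢-sym u≢w))
                  (edge-sym simple v~w ∷ w~x ∷ w~y ∷ [])

  y-w : Edge H y w
  y-w = kept-from (edge-sym simple w~y) (≢-sym (irrefl v~y)) (≢-sym u≢y)

  y-v : Edge H y v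
  y-v = kept-from (edge-sym simple v~y) (≢-sym (irrefl v~y)) (≢-sym u≢y)

  z-z′ : Edge H z z′
  z-z′ = kept-from z~z′ (≢-sym (irrefl v~z)) (≢-sym u≢z)

  z~vtz′ : All (Edge H z) (v ∷ t ∷ z′ ∷ [])
  z~vtz′ = All.map (λ z~q → kept-from z~q (≢-sym (irrefl v~z)) (≢-sym u≢z))
                   (edge-sym simple v~z ∷ z~t ∷ z~z′ ∷ [])

  t-z : Edge H t z
  t-z = kept-from (edge-sym simple z~t) (≢-sym (irrefl v~t)) (≢-sym u≢t)

  t-v : Edge H t v
  t-v = kept-from (edge-sym simple v~t) (≢-sym (irrefl v~t)) (≢-sym u≢t)

  v-proper : Unique (e ∷ map (φe v) (w ∷ z ∷ y ∷ t ∷ []))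
  v-proper = All.map⁺ (All.map (λ v~q → ≢-sym (proj₂ (proj₂ e-missing) _ v~q)) v~wzyt)
           ∷ colours-at φ v~wzyt
               ((w≢z ∷ w≢y ∷ w≢t ∷ []) ∷ (≢-sym y≢z ∷ z≢t ∷ []) ∷ (y≢t ∷ []) ∷ [] ∷ [])

  x-proper : Unique (map (φe x) (u ∷ w ∷ []))
  x-proper = colours-at φ x~uw ((u≢w ∷ []) ∷ [] ∷ [])

  abstract
    R : Recolouring (φe x u) (φe x w) (φe v w) (φe y w) (φe v z) (φe t z) (φe v y) (φe v t) (φe z′ z) e
    R = recolouring _≟_ x-proper v-proper (colours-into φ w~vxy vxy-unique) (colours-into φ z~vtz′ vtz′-unique)

  open Recolouring R

  table : List (Fin 7 × Fin 7 × Fin 9)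
  table = (U , V , uv′) ∷ (U , X , ux′) ∷ (W , V , wv′) ∷ (W , X , wx′) ∷ (W , Y , wy′)
        ∷ (Z , V , zv′) ∷ (Z , T , zt′) ∷ (V , Y , vy′) ∷ (V , T , vt′) ∷ []

  open TableRecolouring G φ labelled labelled-unique table

  exempt : List (Fin n)
  exempt = u ∷ w ∷ z ∷ []

  unchanged⇒kept : ∀ {p q} → Edge G p q → newColour p q ≡ nothing → Edge H p q
  unchanged⇒kept p~q unchanged = deleteEdge-keeps G v u p~q
    (λ { (refl , refl) → unchanged⇒≢ V U refl unchanged refl })
    (λ { (refl , refl) → unchanged⇒≢ U V refl unchanged refl })

  v-freed : All (Freed φ v (w ∷ z ∷ y ∷ t ∷ [])) (e ∷ φe v w ∷ φe v z ∷ φe v y ∷ φe v t ∷ [])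
  v-freed = inj₁ (proj₂ e-missing) ∷ inj₂ (here refl) ∷ inj₂ (there (here refl))
          ∷ inj₂ (there (there (here refl))) ∷ inj₂ (there (there (there (here refl)))) ∷ []

  x-freed : All (Freed φ x (u ∷ w ∷ [])) (φe x u ∷ φe x w ∷ [])
  x-freed = inj₂ (here refl) ∷ inj₂ (there (here refl)) ∷ []

  y-freed : All (Freed φ y (w ∷ v ∷ [])) (φe y w ∷ φe v y ∷ [])
  y-freed = inj₂ (here refl) ∷ inj₂ (there (here (sym (ecol-sym y v y-v)))) ∷ []

  t-freed : All (Freed φ t (z ∷ v ∷ [])) (φe t z ∷ φe v t ∷ [])
  t-freed = inj₂ (here refl) ∷ inj₂ (there (here (sym (ecol-sym t v t-v)))) ∷ []

  star-unique : ∀ ρ → Unique (star table ρ)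
  star-unique V = Unique-resp-↭ (↭-sym at-v) v-proper
  star-unique U = (at-u ∷ []) ∷ [] ∷ []
  star-unique W = at-w
  star-unique Y = Unique-resp-↭ (↭-sym at-y)
    (((λ c≡ → adj-edges y w v y-w y-v (≢-sym (irrefl v~w)) (trans c≡ (sym (ecol-sym y v y-v)))) ∷ []) ∷ [] ∷ [])
  star-unique Z = take⁺ 2 at-z
  star-unique T = Unique-resp-↭ (↭-sym at-t)
    (((λ c≡ → adj-edges t z v t-z t-v (≢-sym (irrefl v~z)) (trans c≡ (sym (ecol-sym t v t-v)))) ∷ []) ∷ [] ∷ [])
  star-unique X = Unique-resp-↭ (↭-sym at-x) x-proper

  ∉-last : ∀ {a b c d : Fin 9} → Unique (a ∷ b ∷ d ∷ []) → c ∈ a ∷ b ∷ [] → c ≢ d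
  ∉-last ((_ ∷ a≢d ∷ []) ∷ _) (here refl)         = a≢d
  ∉-last (_ ∷ (b≢d ∷ []) ∷ _) (there (here refl)) = b≢d

  star-fresh-at-edges : ∀ ρ {c r} → c ∈ star table ρ → Edge G (ι ρ) r → newColour (ι ρ) r ≡ nothing →
                        c ≢ φe (ι ρ) r
  star-fresh-at-edges V c∈ v~r unchanged =
    freed-≢-ecol φ at-v v-freed v~wzyt c∈ (unchanged⇒kept v~r unchanged)
      ( unchanged⇒≢ V W refl unchanged ∷ unchanged⇒≢ V Z refl unchanged
      ∷ unchanged⇒≢ V Y refl unchanged ∷ unchanged⇒≢ V T refl unchanged ∷ [])
  star-fresh-at-edges X c∈ x~r unchanged =
    freed-≢-ecol φ at-x x-freed x~uw c∈ (unchanged⇒kept x~r unchanged)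
      (unchanged⇒≢ X U refl unchanged ∷ unchanged⇒≢ X W refl unchanged ∷ [])
  star-fresh-at-edges Y c∈ y~r unchanged =
    freed-≢-ecol φ at-y y-freed (y-w ∷ y-v ∷ []) c∈ (unchanged⇒kept y~r unchanged)
      (unchanged⇒≢ Y W refl unchanged ∷ unchanged⇒≢ Y V refl unchanged ∷ [])
  star-fresh-at-edges T c∈ t~r unchanged =
    freed-≢-ecol φ at-t t-freed (t-z ∷ t-v ∷ []) c∈ (unchanged⇒kept t~r unchanged)
      (unchanged⇒≢ T Z refl unchanged ∷ unchanged⇒≢ T V refl unchanged ∷ [])
  star-fresh-at-edges U _ u~r unchanged =
    contradiction (u-neighbours u~r)
      (All¬⇒¬Any (unchanged⇒≢ U V refl unchanged ∷ unchanged⇒≢ U X refl unchanged ∷ []))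
  star-fresh-at-edges W _ w~r unchanged =
    contradiction (w-neighbours w~r)
      (All¬⇒¬Any ( unchanged⇒≢ W V refl unchanged ∷ unchanged⇒≢ W X refl unchanged
                 ∷ unchanged⇒≢ W Y refl unchanged ∷ []))
  star-fresh-at-edges Z c∈ z~r unchanged with z-neighbours z~r
  ... | here r≡v                  = contradiction r≡v (unchanged⇒≢ Z V refl unchanged)
  ... | there (here r≡t)          = contradiction r≡t (unchanged⇒≢ Z T refl unchanged)
  ... | there (there (here refl)) = λ c≡ → ∉-last at-z c∈ (trans c≡ (ecol-sym z z′ z-z′))

  star-fresh-at-vertex : ∀ ρ {c} → ι ρ ∉ exempt → c ∈ star table ρ → φv (ι ρ) ≢ c
  star-fresh-at-vertex V _   = freed-≢-vcol φ at-v v-freed v~wzyt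
  star-fresh-at-vertex X _   = freed-≢-vcol φ at-x x-freed x~uw
  star-fresh-at-vertex Y _   = freed-≢-vcol φ at-y y-freed (y-w ∷ y-v ∷ [])
  star-fresh-at-vertex T _   = freed-≢-vcol φ at-t t-freed (t-z ∷ t-v ∷ [])
  star-fresh-at-vertex U u∉ = contradiction (here refl) u∉
  star-fresh-at-vertex W w∉ = contradiction (there (here refl)) w∉
  star-fresh-at-vertex Z z∉ = contradiction (there (there (here refl))) z∉

  admissible : Admissible exempt
  admissible = record
    { unchanged⇒kept = unchanged⇒kept
    ; unexempt⇒kept = λ p~q p∉ q∉ → deleteEdge-keeps G v u p~q
                        (λ { (refl , refl) → q∉ (here refl) }) (λ { (refl , refl) → p∉ (here refl) })
    ; star-unique = star-unique
    ; star-fresh-at-edges = star-fresh-at-edges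
    ; star-fresh-at-vertex = star-fresh-at-vertex }

  colouring : TotalColoring 9 G
  colouring = total-coloring
    (recolour-vertex simple (recolour-vertex simple (recolour-vertex simple (recoloured admissible)
      (deg+deg<9 deg-u (from-yes (4 <? 9))))
      (deg+deg<9 deg-w (from-yes (6 <? 9))))
      (deg+deg<9 deg-z (from-yes (6 <? 9))))
    where
    deg+deg<9 : ∀ {p d} → deg G p ≡ d → d + d < 9 → deg G p + deg G p < 9
    deg+deg<9 refl d+d<9 = d+d<9

lemma2p14 : ∀ {n : ℕ} (G : Graph n) → MinimalCounterexample G → ¬ Config G
lemma2p14 G mc (v , u , w , y , z , t , x , deg-v , v~u , v~w , v~y , v~z , v~t ,
                u≢w , u≢y , u≢z , u≢t , w≢y , w≢z , w≢t , y≢z , y≢t , z≢t ,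
                x≢v , v≁x , u~x , w~x , w~y , z~t , deg-u , deg-w , deg-z) =
  not-colourable (Figure6e.colouring simple deg-v v~u v~w v~y v~z v~t u≢w u≢y u≢z u≢t w≢y w≢z w≢t y≢z y≢t z≢t
                    x≢v v≁x u~x w~x w~y z~t deg-u deg-w deg-z (delE-colorable v u v~u))
  where
  open MinimalCounterexample mc
  simple : IsSimple G
  simple = proj₁ candidate
  not-colourable : ¬ TotalColorable 9 G
  not-colourable = proj₂ (proj₂ (proj₂ (proj₂ candidate)))
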